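{- Let $\mathcal{O}$ be an annotated $\mathcal{ELH}^r$ ontology in normal form and $(B(a_0),m_0)$ an annotated concept assertion. For all $a,b\in{\sf Ind}(\mathcal{O})$ (the individual names occurring in $\mathcal{O}$) and $R\in N_R$, let $C_a$, $C_{{\sf ran}(R)}$ be distinct fresh concept names and $R_{ab}$ distinct fresh role names (not occurring in $\mathcal{O}$). Define $\mathcal{T}_{C_a}=\{(C_a\sqsubseteq A,v)\mid(A(a),v)\in\mathcal{O}\}\cup\{(C_a\sqsubseteq\exists R_{ab},1),(R_{ab}\sqsubseteq R,v),({\sf ran}(R_{ab})\sqsubseteq C_b,1)\mid(R(a,b),v)\in\mathcal{O}\}\cup\{(C_a\sqsubseteq C_{{\sf ran}(R)},v)\mid(R(b,a),v)\in\mathcal{O}\}\cup\{(C_{{\sf ran}(R)}\sqsubseteq C_{{\sf ran}(S)},v)\mid(R\sqsubseteq S,v)\in\mathcal{O}\}\cup\{(C_{{\sf ran}(R)}\sqsubseteq A,v)\mid({\sf ran}(R)\sqsubseteq A,v)\in\mathcal{O}\}$ and $\mathcal{T}=\bigcup_{a\in{\sf Ind}(\mathcal{O})}\mathcal{T}_{C_a}\cup(\mathcal{O}\setminus\{(\alpha,v)\mid\alpha\text{ is an assertion}\})$. Then $\mathcal{O}\models(B(a_0),m_0)$ iff $\mathcal{T}\models(C_{a_0}\sqsubseteq B,m_0)$ or $\mathcal{T}\models(\top\sqsubseteq B,m_0)$.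
   Context: Fix pairwise disjoint countably infinite sets $N_C$, $N_R$, $N_I$, $N_V$ (concept, role, individual names, provenance variables). Monomials: finite products of variables (empty product $1$), $N_M$ their set, computed in the Trio semiring ($\times$ commutative, associative, idempotent), so $m\approx n$ iff they contain the same variables. $\mathcal{ELH}^r$ concepts $C::=A\mid\exists R.C\mid C\sqcap C\mid\top$; axioms: GCIs $C\sqsubseteq D$ with $D::=A\mid\exists R$, role inclusions $R\sqsubseteq S$, range restrictions ${\sf ran}(R)\sqsubseteq A$, assertions $A(a)$ (concept assertions), $R(a,b)$ (role assertions). Annotated ontology: finite set of $(\alpha,v)$, $v\in N_V\cup\{1\}$; normal form: every GCI is $A\sqsubseteq B$, $A\sqcap A'\sqsubseteq B$, $A\sqsubseteq\exists R$ or $\exists R.A\sqsubseteq B$, $A,A'\in N_C\cup\{\top\}$, $B\in N_C$. Annotated interpretation $\mathcal{I}$: domain $\Delta^\mathcal{I}$, disjoint monomial domain $\Delta^\mathcal{I}_m$, $a^\mathcal{I}\in\Delta^\mathcal{I}$, $A^\mathcal{I}\subseteq\Delta^\mathcal{I}\times\Delta^\mathcal{I}_m$, $R^\mathcal{I}\subseteq\Delta^\mathcal{I}\times\Delta^\mathcal{I}\times\Delta^\mathcal{I}_m$, $m^\mathcal{I}\in\Delta^\mathcal{I}_m$ with $m^\mathcal{I}=n^\mathcal{I}$ iff $m\approx n$; $\top^\mathcal{I}=\Delta^\mathcal{I}\times\{1^\mathcal{I}\}$, $(\exists R)^\mathcal{I}=\{(d,\mu)\mid\exists e\,(d,e,\mu)\in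 R^\mathcal{I}\}$, $({\sf ran}(R))^\mathcal{I}=\{(e,\mu)\mid\exists d\,(d,e,\mu)\in R^\mathcal{I}\}$, $(C\sqcap D)^\mathcal{I}=\{(d,(m\times n)^\mathcal{I})\mid(d,m^\mathcal{I})\in C^\mathcal{I},(d,n^\mathcal{I})\in D^\mathcal{I}\}$, $(\exists R.C)^\mathcal{I}=\{(d,(m\times n)^\mathcal{I})\mid\exists e\,(d,e,m^\mathcal{I})\in R^\mathcal{I},(e,n^\mathcal{I})\in C^\mathcal{I}\}$. Satisfaction: $(R\sqsubseteq S,m)$ iff $(d,e,n^\mathcal{I})\in R^\mathcal{I}\Rightarrow(d,e,(m\times n)^\mathcal{I})\in S^\mathcal{I}$ for all $n$; $(G\sqsubseteq D,m)$ iff $(d,n^\mathcal{I})\in G^\mathcal{I}\Rightarrow(d,(m\times n)^\mathcal{I})\in D^\mathcal{I}$ for all $n$; $(A(a),m)$ iff $(a^\mathcal{I},m^\mathcal{I})\in A^\mathcal{I}$; $(R(a,b),m)$ iff $(a^\mathcal{I},b^\mathcal{I},m^\mathcal{I})\in R^\mathcal{I}$. $\mathcal{O}\models(\beta,m)$ iff all models of $\mathcal{O}$ satisfy it. -}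

module Defs where

open import Data.Nat using (ℕ)
open import Data.List using (List; []; _∷_; _++_; map)
open import Data.List.Membership.Propositional using (_∈_)
open import Data.Maybe using (Maybe; just; nothing)
open import Data.Product using (Σ; ∃; ∃-syntax; _×_; _,_)
open import Data.Sum using (_⊎_)
open import Data.Empty using (⊥)
open import Data.Unit using (⊤)
open import Relation.Binary.PropositionalEquality using (_≡_)
open import Function.Bundles using (_⇔_)

-- Trio-semiring equality: same set of variables.

Var : Set
Var = ℕ

Monomial : Set
Monomial = List Var

one : Monomial
one = []

_⊗_ : Monomial → Monomial → Monomial
m ⊗ n = m ++ n

_≈ₘ_ : Monomial → Monomial → Set
m ≈ₘ n = ∀ (x : Var) → (x ∈ m) ⇔ (x ∈ n)

Annot : Set
Annot = Maybe Var

annMon : Annot → Monomial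
annMon nothing  = one
annMon (just x) = x ∷ []

module Syntax (NC NR NI : Set) where

  data Concept : Set where
    atom : NC → Concept
    ex   : NR → Concept → Concept
    _⊓_  : Concept → Concept → Concept
    top  : Concept

  data RHS : Set where
    ratom : NC → RHS
    rex   : NR → RHS

  data Axiom : Set where
    gci     : Concept → RHS → Axiom
    rinc    : NR → NR → Axiom
    ran     : NR → NC → Axiom
    cassert : NC → NI → Axiom
    rassert : NR → NI → NI → Axiom

  AnnAxiom : Set
  AnnAxiom = Axiom × Annot

  Ontology : Set
  Ontology = List AnnAxiom

  IsAssertion : Axiom → Set
  IsAssertion (cassert _ _)   = ⊤
  IsAssertion (rassert _ _ _) = ⊤
  IsAssertion _               = ⊥

  record Interp : Set₁ where
    field
      Δ     : Set
      Δm    : Set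
      mon   : Monomial → Δm
      mon≡  : ∀ m n → (mon m ≡ mon n) ⇔ (m ≈ₘ n)
      ind   : NI → Δ
      conc  : NC → Δ → Δm → Set
      role  : NR → Δ → Δ → Δm → Set

  module _ (I : Interp) where
    open Interp I

    ⟦_⟧ : Concept → Δ → Δm → Set
    ⟦ atom A ⟧ d μ = conc A d μ
    ⟦ top ⟧    d μ = μ ≡ mon one
    ⟦ C ⊓ D ⟧  d μ = ∃[ m ] ∃[ n ] (⟦ C ⟧ d (mon m) × ⟦ D ⟧ d (mon n) × μ ≡ mon (m ⊗ n))
    ⟦ ex R C ⟧ d μ = ∃[ m ] ∃[ n ] ∃[ e ] (role R d e (mon m) × ⟦ C ⟧ e (mon n) × μ ≡ mon (m ⊗ n))

    ⟦_⟧ʳ : RHS → Δ → Δm → Set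
    ⟦ ratom A ⟧ʳ d μ = conc A d μ
    ⟦ rex R ⟧ʳ   d μ = ∃[ e ] role R d e μ

    ⟦ran_⟧ : NR → Δ → Δm → Set
    ⟦ran R ⟧ e μ = ∃[ d ] role R d e μ

    Sat : Axiom → Monomial → Set
    Sat (gci C D) m = ∀ d n → ⟦ C ⟧ d (mon n) → ⟦ D ⟧ʳ d (mon (m ⊗ n))
    Sat (rinc R S) m = ∀ d e n → role R d e (mon n) → role S d e (mon (m ⊗ n))
    Sat (ran R A) m = ∀ e n → ⟦ran R ⟧ e (mon n) → conc A e (mon (m ⊗ n))
    Sat (cassert A a) m = conc A (ind a) (mon m)
    Sat (rassert R a b) m = role R (ind a) (ind b) (mon m)

  ModelOf : (AnnAxiom → Set) → Interp → Set
  ModelOf T I = ∀ α v → T (α , v) → Sat I α (annMon v)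

  _⊨_at_ : (AnnAxiom → Set) → Axiom → Monomial → Set₁
  T ⊨ β at m = ∀ (I : Interp) → ModelOf T I → Sat I β m

  asSet : Ontology → AnnAxiom → Set
  asSet O ax = ax ∈ O

  data Basic : Concept → Set where
    b-atom : ∀ A → Basic (atom A)
    b-top  : Basic top

  data NormalGCI : Concept → RHS → Set where
    nf1 : ∀ {C} B → Basic C → NormalGCI C (ratom B)
    nf2 : ∀ {C C'} B → Basic C → Basic C' → NormalGCI (C ⊓ C') (ratom B)
    nf3 : ∀ {C} R → Basic C → NormalGCI C (rex R)
    nf4 : ∀ {C} R B → Basic C → NormalGCI (ex R C) (ratom B)

  NormalForm : Ontology → Set
  NormalForm O = ∀ C D v → (gci C D , v) ∈ O → NormalGCI C D

open Syntax ℕ ℕ ℕ public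

OccursIn : ℕ → Axiom → Set
OccursIn a (cassert A b)   = a ≡ b
OccursIn a (rassert R b c) = (a ≡ b) ⊎ (a ≡ c)
OccursIn a _               = ⊥

Ind : Ontology → ℕ → Set
Ind O a = ∃[ α ] ∃[ v ] ((α , v) ∈ O × OccursIn a α)

-- Extended signature with fresh names:
--   concept names: the old ones, C_a (a ∈ N_I), C_{ran(R)} (R ∈ N_R)
--   role names:    the old ones, R_{ab} (a, b ∈ N_I)
-- Freshness and pairwise distinctness hold by construction.

data NC⁺ : Set where
  old  : ℕ → NC⁺
  Cind : ℕ → NC⁺
  Cran : ℕ → NC⁺

data NR⁺ : Set where
  oldR  : ℕ → NR⁺
  Rpair : ℕ → ℕ → NR⁺

module Ext = Syntax NC⁺ NR⁺ ℕ

liftC : Concept → Ext.Concept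
liftC (atom A)  = Ext.atom (old A)
liftC (ex R C)  = Ext.ex (oldR R) (liftC C)
liftC (C ⊓ D)   = liftC C Ext.⊓ liftC D
liftC top       = Ext.top

liftD : RHS → Ext.RHS
liftD (ratom A) = Ext.ratom (old A)
liftD (rex R)   = Ext.rex (oldR R)

liftAx : Axiom → Ext.Axiom
liftAx (gci C D)       = Ext.gci (liftC C) (liftD D)
liftAx (rinc R S)      = Ext.rinc (oldR R) (oldR S)
liftAx (ran R A)       = Ext.ran (oldR R) (old A)
liftAx (cassert A a)   = Ext.cassert (old A) a
liftAx (rassert R a b) = Ext.rassert (oldR R) a b

data TCa (O : Ontology) (a : ℕ) : Ext.AnnAxiom → Set where
  t-conc  : ∀ {A v} → (cassert A a , v) ∈ O →
            TCa O a (Ext.gci (Ext.atom (Cind a)) (Ext.ratom (old A)) , v)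
  t-ex    : ∀ {R b v} → (rassert R a b , v) ∈ O →
            TCa O a (Ext.gci (Ext.atom (Cind a)) (Ext.rex (Rpair a b)) , nothing)
  t-sub   : ∀ {R b v} → (rassert R a b , v) ∈ O →
            TCa O a (Ext.rinc (Rpair a b) (oldR R) , v)
  t-ran   : ∀ {R b v} → (rassert R a b , v) ∈ O →
            TCa O a (Ext.ran (Rpair a b) (Cind b) , nothing)
  t-inv   : ∀ {R b v} → (rassert R b a , v) ∈ O →
            TCa O a (Ext.gci (Ext.atom (Cind a)) (Ext.ratom (Cran R)) , v)
  t-rinc  : ∀ {R S v} → (rinc R S , v) ∈ O →
            TCa O a (Ext.gci (Ext.atom (Cran R)) (Ext.ratom (Cran S)) , v)
  t-rran  : ∀ {R A v} → (ran R A , v) ∈ O →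
            TCa O a (Ext.gci (Ext.atom (Cran R)) (Ext.ratom (old A)) , v)

data TBox (O : Ontology) : Ext.AnnAxiom → Set where
  from-TCa : ∀ {a ax} → Ind O a → TCa O a ax → TBox O ax
  from-O   : ∀ {α v} → (α , v) ∈ O → (IsAssertion α → ⊥) →
             TBox O (liftAx α , v)

-- (⇐) A model of O becomes a model of T by reading C_a as {(a, 1)}, C_ran(R) as ran(R) and
-- R_ab as {(a, b, 1)}. (⇒) A completion calculus derives, from a context (an individual a, or
-- an anonymous element in the range of R), atoms together with their provenance. Reading the
-- context a as C_a and the range context as C_ran(R), every derivation is sound in all models of
-- T, and the derivations themselves form a canonical model of O. So O ⊨ (B(a₀), m₀) yields a
-- derivation of B from the context a₀, which gives T ⊨ C_a₀ ⊑ B if it uses the context and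
-- T ⊨ ⊤ ⊑ B if it does not. Since an interpretation must identify monomials exactly up to ≈,
-- the canonical model uses canonical representatives of monomials as its monomial domain.

module Submission where

open import Defs
open import Data.Nat using (ℕ)
open import Data.Sum using (_⊎_)
open import Function.Bundles using (_⇔_)

open import Algebra.Bundles using (IdempotentCommutativeMonoid; CommutativeMonoid)
open import Data.Bool using (Bool; true; false; _∨_)
open import Data.Empty using (⊥)
open import Data.List using (List; []; _∷_; length)
open import Data.List.Extrema.Nat using (max; xs≤max; max-mono-⊆)
open import Data.List.Membership.Propositional using (_∈_)
open import Data.List.Properties using (∷-injective)
open import Data.List.Relation.Binary.BagAndSetEquality using (commutativeMonoid; set; ++-idempotent)
open import Data.List.Relation.Unary.All as All using ()
open import Data.Nat using (zero; suc; _<_; _≤_; s≤s; z≤n; _≟_)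
open import Data.List.Membership.DecPropositional _≟_ using (_∈?_)
open import Data.Nat.Properties using (≤-antisym; m≤n⇒m<n∨m≡n; suc-injective)
open import Data.Product using (_×_; _,_; ∃-syntax)
open import Data.Sum using (inj₁; inj₂)
open import Data.Unit using (⊤; tt)
open import Function using (_∘′_)
open import Function.Bundles using (mk⇔; Equivalence)
open import Relation.Binary.PropositionalEquality using (_≡_; refl; sym; trans; cong; cong₂; subst)
open import Relation.Nullary using (yes; no; does; contradiction)
open import Relation.Nullary.Decidable using (dec-true)

open Equivalence

monomials : IdempotentCommutativeMonoid _ _
monomials = record
  { isIdempotentCommutativeMonoid = record
    { isCommutativeMonoid = CommutativeMonoid.isCommutativeMonoid (commutativeMonoid set Var)
    ; idem                = ++-idempotent
    }
  }

open IdempotentCommutativeMonoid monomials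
  using (_≈_; setoid; assoc; idem; identityʳ; ∙-cong; ∙-congˡ; ∙-congʳ)
  renaming (refl to ≈-refl; sym to ≈-sym; trans to ≈-trans)
open import Algebra.Solver.IdempotentCommutativeMonoid monomials using (solve; _⊜_; _⊕_)
open import Relation.Binary.Reasoning.Setoid setoid

≈⇒≈ₘ : ∀ {m n} → m ≈ n → m ≈ₘ n
≈⇒≈ₘ m≈n x = m≈n

≈ₘ⇒≈ : ∀ {m n} → m ≈ₘ n → m ≈ n
≈ₘ⇒≈ m≈n {x} = m≈n x

membership : ℕ → Monomial → List Bool
membership zero    m = []
membership (suc k) m = does (k ∈? m) ∷ membership k m

-- The suc keeps [] and [0] apart.
canon : Monomial → List Bool
canon m = membership (suc (max 0 m)) m

∈⇒≤max : ∀ {x m} → x ∈ m → x ≤ max 0 m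
∈⇒≤max {m = m} x∈m = All.lookup (xs≤max 0 m) x∈m

max-cong : ∀ {m n} → m ≈ n → max 0 m ≡ max 0 n
max-cong m≈n = ≤-antisym (max-mono-⊆ z≤n (to m≈n)) (max-mono-⊆ z≤n (from m≈n))

does-∈-cong : ∀ x {m n} → m ≈ n → does (x ∈? m) ≡ does (x ∈? n)
does-∈-cong x {m} {n} m≈n with x ∈? m | x ∈? n
... | yes _   | yes _   = refl
... | no  _   | no  _   = refl
... | yes x∈m | no  x∉n = contradiction (to m≈n x∈m) x∉n
... | no  x∉m | yes x∈n = contradiction (from m≈n x∈n) x∉m

∈-transfer : ∀ {x m n} → does (x ∈? m) ≡ does (x ∈? n) → x ∈ m → x ∈ n
∈-transfer {x} {m} {n} eq x∈m with x ∈? n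
... | yes x∈n = x∈n
... | no  _   with () ← trans (sym (dec-true (x ∈? m) x∈m)) eq

membership-cong : ∀ k {m n} → m ≈ n → membership k m ≡ membership k n
membership-cong zero    m≈n = refl
membership-cong (suc k) m≈n = cong₂ _∷_ (does-∈-cong k m≈n) (membership-cong k m≈n)

length-membership : ∀ k m → length (membership k m) ≡ k
length-membership zero    m = refl
length-membership (suc k) m = cong suc (length-membership k m)

membership-reflects : ∀ k {m n x} → membership k m ≡ membership k n → x < k → x ∈ m → x ∈ n
membership-reflects (suc k) eq x<1+k x∈m with m≤n⇒m<n∨m≡n x<1+k | ∷-injective eq
... | inj₂ refl      | eqₓ , _   = ∈-transfer eqₓ x∈m
... | inj₁ (s≤s x<k) | _   , eqₖ = membership-reflects k eqₖ x<k x∈m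

canon-sound : ∀ {m n} → m ≈ n → canon m ≡ canon n
canon-sound {m} {n} m≈n rewrite max-cong m≈n = membership-cong (suc (max 0 n)) m≈n

canon-⊆ : ∀ {m n x} → canon m ≡ canon n → x ∈ m → x ∈ n
canon-⊆ {m} {n} eq x∈m = membership-reflects (suc (max 0 m)) eq′ (s≤s (∈⇒≤max x∈m)) x∈m
  where
  max≡ : max 0 m ≡ max 0 n
  max≡ = suc-injective (trans (sym (length-membership _ m))
                              (trans (cong length eq) (length-membership _ n)))
  eq′ : canon m ≡ membership (suc (max 0 m)) n
  eq′ = trans eq (cong (λ k → membership (suc k) n) (sym max≡))

canon-complete : ∀ {m n} → canon m ≡ canon n → m ≈ n
canon-complete eq = mk⇔ (canon-⊆ eq) (canon-⊆ (sym eq))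

canon-≡⇔≈ₘ : ∀ m n → (canon m ≡ canon n) ⇔ (m ≈ₘ n)
canon-≡⇔≈ₘ m n = mk⇔ (≈⇒≈ₘ ∘′ canon-complete) (canon-sound ∘′ ≈ₘ⇒≈)

canon-⊗ : ∀ v {n m p} → canon n ≡ canon m → v ⊗ m ≈ p → canon (v ⊗ n) ≡ canon p
canon-⊗ v n≡m vm≈p = canon-sound (≈-trans (∙-congˡ {v} (canon-complete n≡m)) vm≈p)

canon-∙ : ∀ {n m₁ m₂ p₁ p₂} → canon n ≡ canon (m₁ ⊗ m₂) →
          canon m₁ ≡ canon p₁ → canon m₂ ≡ canon p₂ → canon n ≡ canon (p₁ ⊗ p₂)
canon-∙ eq eq₁ eq₂ = trans eq (canon-sound (∙-cong (canon-complete eq₁) (canon-complete eq₂)))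

module _ {NC NR NI : Set} (I : Syntax.Interp NC NR NI) where
  open Syntax.Interp I

  mon-cong : ∀ {m n} → m ≈ n → mon m ≡ mon n
  mon-cong m≈n = from (mon≡ _ _) (≈⇒≈ₘ m≈n)

  mon-injective : ∀ {m n} → mon m ≡ mon n → m ≈ n
  mon-injective eq = ≈ₘ⇒≈ (to (mon≡ _ _) eq)

  mon-subst : (P : Δm → Set) → ∀ {m n} → m ≈ n → P (mon m) → P (mon n)
  mon-subst P m≈n = subst P (mon-cong m≈n)

ifUsed : Bool → Monomial → Monomial
ifUsed true  n = n
ifUsed false n = one

ifUsed-∨ : ∀ f₁ f₂ n → ifUsed f₁ n ⊗ ifUsed f₂ n ≈ ifUsed (f₁ ∨ f₂) n
ifUsed-∨ true  true  n = idem n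
ifUsed-∨ true  false n = identityʳ n
ifUsed-∨ false _     n = ≈-refl

ifUsed-absorb : ∀ f n → n ⊗ ifUsed f n ≈ n
ifUsed-absorb true  n = idem n
ifUsed-absorb false n = identityʳ n

⊓-provenance : ∀ v k₁ k₂ f₁ f₂ n →
  v ⊗ ((k₁ ⊗ ifUsed f₁ n) ⊗ (k₂ ⊗ ifUsed f₂ n)) ≈ (v ⊗ (k₁ ⊗ k₂)) ⊗ ifUsed (f₁ ∨ f₂) n
⊓-provenance v k₁ k₂ f₁ f₂ n = begin
  v ⊗ ((k₁ ⊗ ifUsed f₁ n) ⊗ (k₂ ⊗ ifUsed f₂ n))
    ≈⟨ solve 5 (λ v k₁ k₂ s₁ s₂ → v ⊕ ((k₁ ⊕ s₁) ⊕ (k₂ ⊕ s₂)) ⊜ (v ⊕ (k₁ ⊕ k₂)) ⊕ (s₁ ⊕ s₂)) ≈-refl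
         v k₁ k₂ (ifUsed f₁ n) (ifUsed f₂ n) ⟩
  (v ⊗ (k₁ ⊗ k₂)) ⊗ (ifUsed f₁ n ⊗ ifUsed f₂ n)
    ≈⟨ ∙-congˡ {v ⊗ (k₁ ⊗ k₂)} (ifUsed-∨ f₁ f₂ n) ⟩
  (v ⊗ (k₁ ⊗ k₂)) ⊗ ifUsed (f₁ ∨ f₂) n ∎

∃-anon-provenance : ∀ v w k₀ s k f →
  v ⊗ ((w ⊗ (k₀ ⊗ s)) ⊗ (k ⊗ ifUsed f (k₀ ⊗ s))) ≈ (v ⊗ ((w ⊗ k₀) ⊗ k)) ⊗ s
∃-anon-provenance v w k₀ s k f = begin
  v ⊗ ((w ⊗ (k₀ ⊗ s)) ⊗ (k ⊗ ifUsed f (k₀ ⊗ s)))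
    ≈⟨ solve 6 (λ v w k₀ s k t → v ⊕ ((w ⊕ (k₀ ⊕ s)) ⊕ (k ⊕ t)) ⊜ (v ⊕ (w ⊕ k)) ⊕ ((k₀ ⊕ s) ⊕ t)) ≈-refl
         v w k₀ s k (ifUsed f (k₀ ⊗ s)) ⟩
  (v ⊗ (w ⊗ k)) ⊗ ((k₀ ⊗ s) ⊗ ifUsed f (k₀ ⊗ s))
    ≈⟨ ∙-congˡ {v ⊗ (w ⊗ k)} (ifUsed-absorb f (k₀ ⊗ s)) ⟩
  (v ⊗ (w ⊗ k)) ⊗ (k₀ ⊗ s)
    ≈⟨ solve 5 (λ v w k₀ s k → (v ⊕ (w ⊕ k)) ⊕ (k₀ ⊕ s) ⊜ (v ⊕ ((w ⊕ k₀) ⊕ k)) ⊕ s) ≈-refl v w k₀ s k ⟩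
  (v ⊗ ((w ⊗ k₀) ⊗ k)) ⊗ s ∎

∃-named-provenance : ∀ v w u k f n →
  v ⊗ ((w ⊗ (u ⊗ n)) ⊗ (k ⊗ ifUsed f n)) ≈ (v ⊗ ((w ⊗ u) ⊗ k)) ⊗ n
∃-named-provenance v w u k f n = begin
  v ⊗ ((w ⊗ (u ⊗ n)) ⊗ (k ⊗ ifUsed f n))
    ≈⟨ solve 6 (λ v w u k n s → v ⊕ ((w ⊕ (u ⊕ n)) ⊕ (k ⊕ s)) ⊜ (v ⊕ ((w ⊕ u) ⊕ k)) ⊕ (n ⊕ s)) ≈-refl
         v w u k n (ifUsed f n) ⟩
  (v ⊗ ((w ⊗ u) ⊗ k)) ⊗ (n ⊗ ifUsed f n)
    ≈⟨ ∙-congˡ {v ⊗ ((w ⊗ u) ⊗ k)} (ifUsed-absorb f n) ⟩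
  (v ⊗ ((w ⊗ u) ⊗ k)) ⊗ n ∎

assoc³ : ∀ u w v n → u ⊗ (w ⊗ (v ⊗ n)) ≈ (u ⊗ (w ⊗ v)) ⊗ n
assoc³ u w v n = ≈-sym (≈-trans (assoc u (w ⊗ v) n) (∙-congˡ {u} (assoc w v n)))

data Context : Set where
  named : ℕ → Context
  anon  : ℕ → Context

data Target : Set where
  atomᵗ : ℕ → Target
  ⊤ᵗ    : Target
  ∃ᵗ    : ℕ → Target

basicᵗ : ∀ {C} → Basic C → Target
basicᵗ (b-atom A) = atomᵗ A
basicᵗ b-top      = ⊤ᵗ

rhsᵗ : RHS → Target
rhsᵗ (ratom B) = atomᵗ B
rhsᵗ (rex R)   = ∃ᵗ R

module _ (O : Ontology) where

  data RoleChain : ℕ → ℕ → Monomial → Set where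
    ⊑-refl : ∀ {R} → RoleChain R R one
    ⊑-step : ∀ {R S T w v} → RoleChain R S w → (rinc S T , v) ∈ O → RoleChain R T (annMon v ⊗ w)

  -- Meaning (see sound): in every model of T, each element in context s with provenance n
  -- (in C_a for named a, in ran(R) for anon R) satisfies t with provenance k × n; when f = false
  -- the context is not used and every element satisfies t with provenance k.
  data Derivation : Context → Target → Monomial → Bool → Set where
    ⊤-intro     : ∀ {s} → Derivation s ⊤ᵗ one false
    assertion   : ∀ {A a v} → (cassert A a , v) ∈ O → Derivation (named a) (atomᵗ A) (annMon v) true
    range-named : ∀ {R S A a b v w u} →
                  (rassert R b a , v) ∈ O → RoleChain R S w → (ran S A , u) ∈ O →
                  Derivation (named a) (atomᵗ A) (annMon u ⊗ (w ⊗ annMon v)) true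
    range-anon  : ∀ {R S A w u} → RoleChain R S w → (ran S A , u) ∈ O →
                  Derivation (anon R) (atomᵗ A) (annMon u ⊗ w) true
    gci-basic   : ∀ {s C D v k f} (bC : Basic C) → (gci C D , v) ∈ O →
                  Derivation s (basicᵗ bC) k f → Derivation s (rhsᵗ D) (annMon v ⊗ k) f
    gci-⊓       : ∀ {s C C′ D v k₁ k₂ f₁ f₂} (bC : Basic C) (bC′ : Basic C′) → (gci (C ⊓ C′) D , v) ∈ O →
                  Derivation s (basicᵗ bC) k₁ f₁ → Derivation s (basicᵗ bC′) k₂ f₂ →
                  Derivation s (rhsᵗ D) (annMon v ⊗ (k₁ ⊗ k₂)) (f₁ ∨ f₂)
    gci-∃-anon  : ∀ {s C R R′ D v k₀ f₀ w k f} (bC : Basic C) → (gci (ex R C) D , v) ∈ O →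
                  Derivation s (∃ᵗ R′) k₀ f₀ → RoleChain R′ R w → Derivation (anon R′) (basicᵗ bC) k f →
                  Derivation s (rhsᵗ D) (annMon v ⊗ ((w ⊗ k₀) ⊗ k)) f₀
    gci-∃-named : ∀ {C R R′ D v a c u w k f} (bC : Basic C) → (gci (ex R C) D , v) ∈ O →
                  (rassert R′ a c , u) ∈ O → RoleChain R′ R w → Derivation (named c) (basicᵗ bC) k f →
                  Derivation (named a) (rhsᵗ D) (annMon v ⊗ ((w ⊗ annMon u) ⊗ k)) true

  module Soundness (J : Ext.Interp) (J⊨T : Ext.ModelOf (TBox O) J) where
    open Ext.Interp J

    ⟦_⟧ᵗ : Target → Δ → Δm → Set
    ⟦ atomᵗ A ⟧ᵗ d μ = conc (old A) d μ
    ⟦ ⊤ᵗ ⟧ᵗ      d μ = μ ≡ mon one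
    ⟦ ∃ᵗ R ⟧ᵗ    d μ = ∃[ e ] role (oldR R) d e μ

    ⟦_⟧ᶜ : Context → Δ → Monomial → Set
    ⟦ named a ⟧ᶜ d n = conc (Cind a) d (mon n)
    ⟦ anon R ⟧ᶜ  e n = ∃[ d ] role (oldR R) d e (mon n)

    InContext : Context → Bool → Δ → Monomial → Set
    InContext s true  d n = ⟦ s ⟧ᶜ d n
    InContext s false d n = ⊤

    inContext : ∀ {s d n} → ⟦ s ⟧ᶜ d n → ∀ f → InContext s f d n
    inContext h true  = h
    inContext h false = tt

    inContext-∨ : ∀ {s d n} f₁ f₂ → InContext s (f₁ ∨ f₂) d n → InContext s f₁ d n × InContext s f₂ d n
    inContext-∨ true  f₂    h = h , inContext h f₂
    inContext-∨ false true  h = tt , h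
    inContext-∨ false false h = tt , tt

    basic-lift : ∀ {C} (bC : Basic C) {d μ} → ⟦ basicᵗ bC ⟧ᵗ d μ → Ext.⟦_⟧ J (liftC C) d μ
    basic-lift (b-atom A) h = h
    basic-lift b-top      h = h

    rhs-unlift : ∀ D {d μ} → Ext.⟦_⟧ʳ J (liftD D) d μ → ⟦ rhsᵗ D ⟧ᵗ d μ
    rhs-unlift (ratom B) h = h
    rhs-unlift (rex R)   h = h

    tbox-axiom : ∀ {α v} → (α , v) ∈ O → (IsAssertion α → ⊥) → Ext.Sat J (liftAx α) (annMon v)
    tbox-axiom ax ¬assertion = J⊨T _ _ (from-O ax ¬assertion)

    chain-role : ∀ {R S w d e n} → RoleChain R S w →
                 role (oldR R) d e (mon n) → role (oldR S) d e (mon (w ⊗ n))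
    chain-role ⊑-refl h = h
    chain-role {n = n} (⊑-step {w = w} {v} chain ax) h =
      mon-subst J (role _ _ _) (≈-sym (assoc (annMon v) w n)) (tbox-axiom ax (λ ()) _ _ _ (chain-role chain h))

    chain-range : ∀ {a R S w d n} → Ind O a → RoleChain R S w →
                  conc (Cran R) d (mon n) → conc (Cran S) d (mon (w ⊗ n))
    chain-range a∈O ⊑-refl h = h
    chain-range {n = n} a∈O (⊑-step {w = w} {v} chain ax) h =
      mon-subst J (conc _ _) (≈-sym (assoc (annMon v) w n))
        (J⊨T _ _ (from-TCa a∈O (t-rinc ax)) _ _ (chain-range a∈O chain h))

    named-successor : ∀ {R a c u d n} → (rassert R a c , u) ∈ O → conc (Cind a) d (mon n) →
                      ∃[ e ] role (oldR R) d e (mon (annMon u ⊗ n)) × conc (Cind c) e (mon n)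
    named-successor {d = d} {n} asr d∈Ca =
      let e , r = J⊨T _ _ (from-TCa a∈O (t-ex asr)) d n d∈Ca in
      e , J⊨T _ _ (from-TCa a∈O (t-sub asr)) d e n r , J⊨T _ _ (from-TCa a∈O (t-ran asr)) e n (d , r)
      where a∈O = _ , _ , asr , inj₁ refl

    sound : ∀ {s t k f} → Derivation s t k f → ∀ d n → InContext s f d n → ⟦ t ⟧ᵗ d (mon (k ⊗ ifUsed f n))
    sound ⊤-intro d n _ = refl
    sound (assertion ax) d n h = J⊨T _ _ (from-TCa (_ , _ , ax , refl) (t-conc ax)) d n h
    sound (range-named {v = v} {w} {u} ax chain rax) d n h =
      mon-subst J (conc _ _) (assoc³ (annMon u) w (annMon v) n)
        (J⊨T _ _ (from-TCa a∈O (t-rran rax)) d _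
          (chain-range a∈O chain (J⊨T _ _ (from-TCa a∈O (t-inv ax)) d n h)))
      where a∈O = _ , _ , ax , inj₂ refl
    sound (range-anon {w = w} {u} chain rax) e n (d , h) =
      mon-subst J (conc _ _) (≈-sym (assoc (annMon u) w n))
        (tbox-axiom rax (λ ()) e _ (d , chain-role chain h))
    sound (gci-basic {D = D} {v} {k} {f} bC ax der) d n h =
      mon-subst J (⟦ rhsᵗ D ⟧ᵗ d) (≈-sym (assoc (annMon v) k (ifUsed f n)))
        (rhs-unlift D (tbox-axiom ax (λ ()) d _ (basic-lift bC (sound der d n h))))
    sound (gci-⊓ {D = D} {v} {k₁} {k₂} {f₁} {f₂} bC bC′ ax der₁ der₂) d n h =
      let h₁ , h₂ = inContext-∨ f₁ f₂ h in
      mon-subst J (⟦ rhsᵗ D ⟧ᵗ d) (⊓-provenance (annMon v) k₁ k₂ f₁ f₂ n)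
        (rhs-unlift D (tbox-axiom ax (λ ()) d _
          (_ , _ , basic-lift bC (sound der₁ d n h₁) , basic-lift bC′ (sound der₂ d n h₂) , refl)))
    sound (gci-∃-anon {D = D} {v} {k₀} {f₀} {w} {k} {f} bC ax der₀ chain der) d n h =
      let e , r = sound der₀ d n h in
      mon-subst J (⟦ rhsᵗ D ⟧ᵗ d) (∃-anon-provenance (annMon v) w k₀ (ifUsed f₀ n) k f)
        (rhs-unlift D (tbox-axiom ax (λ ()) d _
          (_ , _ , e , chain-role chain r , basic-lift bC (sound der e _ (inContext (d , r) f)) , refl)))
    sound (gci-∃-named {D = D} {v} {u = u} {w} {k} {f} bC ax asr chain der) d n h =
      let e , r , e∈Cc = named-successor asr h in
      mon-subst J (⟦ rhsᵗ D ⟧ᵗ d) (∃-named-provenance (annMon v) w (annMon u) k f n)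
        (rhs-unlift D (tbox-axiom ax (λ ()) d _
          (_ , _ , e , chain-role chain r , basic-lift bC (sound der e n (inContext e∈Cc f)) , refl)))

  Dom : Set
  Dom = Context × Monomial

  data Fact : Dom → Target → List Bool → Set where
    fact : ∀ {s b t k f μ} → Derivation s t k f → μ ≡ canon (k ⊗ ifUsed f b) → Fact (s , b) t μ

  -- A ∃R′-derivation at (s, b) creates the successor (anon R′, p) where p is the provenance of
  -- the edge; role assertions link named elements within one context b.
  data Edge (R : ℕ) : Dom → Dom → List Bool → Set where
    to-anon  : ∀ {s b R′ k₀ f₀ w μ} → Derivation s (∃ᵗ R′) k₀ f₀ → RoleChain R′ R w →
               μ ≡ canon (w ⊗ (k₀ ⊗ ifUsed f₀ b)) → Edge R (s , b) (anon R′ , k₀ ⊗ ifUsed f₀ b) μ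
    to-named : ∀ {a c b R′ u w μ} → (rassert R′ a c , u) ∈ O → RoleChain R′ R w →
               μ ≡ canon (w ⊗ (annMon u ⊗ b)) → Edge R (named a , b) (named c , b) μ

  canonical : Interp
  canonical = record
    { Δ    = Dom
    ; Δm   = List Bool
    ; mon  = canon
    ; mon≡ = canon-≡⇔≈ₘ
    ; ind  = λ a → named a , one
    ; conc = λ A x → Fact x (atomᵗ A)
    ; role = Edge
    }

  basic-fact : ∀ {C} (bC : Basic C) {x μ} → ⟦_⟧ canonical C x μ → Fact x (basicᵗ bC) μ
  basic-fact (b-atom A) h = h
  basic-fact b-top      h = fact ⊤-intro h

  gci-sat : ∀ {C D v} → (gci C D , v) ∈ O → NormalGCI C D → Sat canonical (gci C D) (annMon v)
  gci-sat {v = v} ax (nf1 B bC) x n h with basic-fact bC h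
  ... | fact {k = k} {f} der eq =
    fact (gci-basic bC ax der) (canon-⊗ (annMon v) eq (≈-sym (assoc (annMon v) k (ifUsed f _))))
  gci-sat {v = v} ax (nf2 B bC bC′) x n (_ , _ , h₁ , h₂ , eq) with basic-fact bC h₁ | basic-fact bC′ h₂
  ... | fact {k = k₁} {f₁} der₁ eq₁ | fact {k = k₂} {f₂} der₂ eq₂ =
    fact (gci-⊓ bC bC′ ax der₁ der₂)
      (canon-⊗ (annMon v) (canon-∙ eq eq₁ eq₂) (⊓-provenance (annMon v) k₁ k₂ f₁ f₂ _))
  gci-sat {v = v} ax (nf3 R bC) x n h with basic-fact bC h
  ... | fact {k = k} {f} der eq =
    _ , to-anon (gci-basic bC ax der) ⊑-refl (canon-⊗ (annMon v) eq (≈-sym (assoc (annMon v) k (ifUsed f _))))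
  gci-sat {v = v} ax (nf4 R B bC) x n (_ , _ , y , edge , h , eq) with edge | basic-fact bC h
  ... | to-anon {f₀ = f₀} {w} der₀ chain eq₁ | fact {k = k} {f} der eq₂ =
    fact (gci-∃-anon bC ax der₀ chain der)
      (canon-⊗ (annMon v) (canon-∙ eq eq₁ eq₂) (∃-anon-provenance (annMon v) w _ (ifUsed f₀ _) k f))
  ... | to-named {u = u} {w} asr chain eq₁ | fact {k = k} {f} der eq₂ =
    fact (gci-∃-named bC ax asr chain der)
      (canon-⊗ (annMon v) (canon-∙ eq eq₁ eq₂) (∃-named-provenance (annMon v) w (annMon u) k f _))

  canonical-model : NormalForm O → ModelOf (asSet O) canonical
  canonical-model nf (gci C D) v ax = gci-sat ax (nf C D v ax)
  canonical-model nf (rinc R S) v ax x y n (to-anon {b = b} {k₀ = k₀} {f₀} {w} der chain eq) =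
    to-anon der (⊑-step chain ax) (canon-⊗ (annMon v) eq (≈-sym (assoc (annMon v) w (k₀ ⊗ ifUsed f₀ b))))
  canonical-model nf (rinc R S) v ax x y n (to-named {b = b} {u = u} {w} asr chain eq) =
    to-named asr (⊑-step chain ax) (canon-⊗ (annMon v) eq (≈-sym (assoc (annMon v) w (annMon u ⊗ b))))
  canonical-model nf (ran R A) v ax y n (x , to-anon {b = b} {k₀ = k₀} {f₀} {w} der chain eq) =
    fact (range-anon chain ax) (canon-⊗ (annMon v) eq (≈-sym (assoc (annMon v) w (k₀ ⊗ ifUsed f₀ b))))
  canonical-model nf (ran R A) v ax y n (x , to-named {u = u} {w} asr chain eq) =
    fact (range-named asr chain ax) (canon-⊗ (annMon v) eq (assoc³ (annMon v) w (annMon u) _))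
  canonical-model nf (cassert A a) v ax = fact (assertion ax) (canon-sound (≈-sym (identityʳ (annMon v))))
  canonical-model nf (rassert R a b) v ax = to-named ax ⊑-refl (canon-sound (≈-sym (identityʳ (annMon v))))

  assertion⇒tbox : NormalForm O → ∀ B a₀ m₀ → asSet O ⊨ cassert B a₀ at m₀ →
    (TBox O Ext.⊨ Ext.gci (Ext.atom (Cind a₀)) (Ext.ratom (old B)) at m₀)
    ⊎ (TBox O Ext.⊨ Ext.gci Ext.top (Ext.ratom (old B)) at m₀)
  assertion⇒tbox nf B a₀ m₀ O⊨B with O⊨B canonical (canonical-model nf)
  ... | fact {k = k} {true} der eq = inj₁ λ J J⊨T d n h →
    mon-subst J (Ext.Interp.conc J (old B) d) (∙-congʳ {n} k≈m₀)
      (Soundness.sound J J⊨T der d n h)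
    where k≈m₀ = ≈-trans (≈-sym (identityʳ k)) (≈-sym (canon-complete eq))
  ... | fact {k = k} {false} der eq = inj₂ λ J J⊨T d n h →
    mon-subst J (Ext.Interp.conc J (old B) d)
      (≈-trans (≈-sym (canon-complete eq)) (≈-trans (≈-sym (identityʳ m₀)) (∙-congˡ {m₀} (≈-sym (mon-injective J h)))))
      (Soundness.sound J J⊨T der d n tt)

  module TBoxExtension (I : Interp) (I⊨O : ModelOf (asSet O) I) where
    open Interp I

    conc⁺ : NC⁺ → Δ → Δm → Set
    conc⁺ (old A)  d μ = conc A d μ
    conc⁺ (Cind a) d μ = (d ≡ ind a) × (μ ≡ mon one)
    conc⁺ (Cran R) d μ = ∃[ d′ ] role R d′ d μ

    role⁺ : NR⁺ → Δ → Δ → Δm → Set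
    role⁺ (oldR R)    d e μ = role R d e μ
    role⁺ (Rpair a b) d e μ = (d ≡ ind a) × (e ≡ ind b) × (μ ≡ mon one)

    extension : Ext.Interp
    extension = record { Δ = Δ ; Δm = Δm ; mon = mon ; mon≡ = mon≡ ; ind = ind ; conc = conc⁺ ; role = role⁺ }

    liftC-reflects : ∀ C {d μ} → Ext.⟦_⟧ extension (liftC C) d μ → ⟦_⟧ I C d μ
    liftC-reflects (atom A) h = h
    liftC-reflects (ex R C) (m , n , e , r , h , eq) = m , n , e , r , liftC-reflects C h , eq
    liftC-reflects (C ⊓ D)  (m , n , h₁ , h₂ , eq) = m , n , liftC-reflects C h₁ , liftC-reflects D h₂ , eq
    liftC-reflects top      h = h

    liftD-preserves : ∀ D {d μ} → ⟦_⟧ʳ I D d μ → Ext.⟦_⟧ʳ extension (liftD D) d μ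
    liftD-preserves (ratom A) h = h
    liftD-preserves (rex R)   h = h

    ⊗-unit : ∀ {n} → mon n ≡ mon one → ∀ m → m ≈ m ⊗ n
    ⊗-unit n≡1 m = ≈-sym (≈-trans (∙-congˡ {m} (mon-injective I n≡1)) (identityʳ m))

    lifted-sat : ∀ α v → (α , v) ∈ O → (IsAssertion α → ⊥) → Ext.Sat extension (liftAx α) (annMon v)
    lifted-sat (gci C D)       v ax _ d n h = liftD-preserves D (I⊨O _ v ax d n (liftC-reflects C h))
    lifted-sat (rinc R S)      v ax _ = I⊨O _ v ax
    lifted-sat (ran R A)       v ax _ = I⊨O _ v ax
    lifted-sat (cassert A a)   v ax ¬assertion = contradiction tt ¬assertion
    lifted-sat (rassert R a b) v ax ¬assertion = contradiction tt ¬assertion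

    TCa-sat : ∀ a α v → TCa O a (α , v) → Ext.Sat extension α (annMon v)
    TCa-sat a _ _ (t-conc {v = v} ax) d n (refl , h) = mon-subst I (conc _ d) (⊗-unit h (annMon v)) (I⊨O _ v ax)
    TCa-sat a _ _ (t-ex {b = b} ax)   d n (refl , h) = ind b , refl , refl , h
    TCa-sat a _ _ (t-sub {v = v} ax)  d e n (refl , refl , h) = mon-subst I (role _ d e) (⊗-unit h (annMon v)) (I⊨O _ v ax)
    TCa-sat a _ _ (t-ran ax)          e n (d , refl , refl , h) = refl , h
    TCa-sat a _ _ (t-inv {v = v} ax)  d n (refl , h) = _ , mon-subst I (role _ _ d) (⊗-unit h (annMon v)) (I⊨O _ v ax)
    TCa-sat a _ _ (t-rinc {v = v} ax) d n (d′ , r) = d′ , I⊨O _ v ax d′ d n r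
    TCa-sat a _ _ (t-rran {v = v} ax) d n h = I⊨O _ v ax d n h

    extension-model : Ext.ModelOf (TBox O) extension
    extension-model α v (from-TCa {a = a} _ t)     = TCa-sat a α v t
    extension-model _ _ (from-O {α = α} {v} ax ¬a) = lifted-sat α v ax ¬a

  tbox⇒assertion : ∀ B a₀ m₀ →
    (TBox O Ext.⊨ Ext.gci (Ext.atom (Cind a₀)) (Ext.ratom (old B)) at m₀)
    ⊎ (TBox O Ext.⊨ Ext.gci Ext.top (Ext.ratom (old B)) at m₀) →
    asSet O ⊨ cassert B a₀ at m₀
  tbox⇒assertion B a₀ m₀ (inj₁ T⊨Ca⊑B) I I⊨O =
    mon-subst I (Interp.conc I B (Interp.ind I a₀)) (identityʳ m₀)
      (T⊨Ca⊑B extension extension-model (Interp.ind I a₀) one (refl , refl))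
    where open TBoxExtension I I⊨O
  tbox⇒assertion B a₀ m₀ (inj₂ T⊨⊤⊑B) I I⊨O =
    mon-subst I (Interp.conc I B (Interp.ind I a₀)) (identityʳ m₀)
      (T⊨⊤⊑B extension extension-model (Interp.ind I a₀) one refl)
    where open TBoxExtension I I⊨O

proposition6 : (O : Ontology) → NormalForm O →
    (B a₀ : ℕ) (m₀ : Monomial) → Ind O a₀ →
    (asSet O ⊨ cassert B a₀ at m₀)
      ⇔ ((TBox O Ext.⊨ Ext.gci (Ext.atom (Cind a₀)) (Ext.ratom (old B)) at m₀)
         ⊎ (TBox O Ext.⊨ Ext.gci Ext.top (Ext.ratom (old B)) at m₀))
-- The reduction is correct for every a₀.
proposition6 O nf B a₀ m₀ _ =
  mk⇔ (assertion⇒tbox O nf B a₀ m₀) (tbox⇒assertion O B a₀ m₀)
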